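{- Let $n\ge 1$, let $G$ be a graph and let $f:G\to P_n^{(3)}$ be a covering projection. Suppose $G$ contains as a subgraph a path $Q$ with vertices $q_1,q_2,\dots,q_m$ (in order) such that every vertex of $Q$ is incident in $G$ with a semi-edge. Then the sequence $(f(q_1),\dots,f(q_m))$ coincides with a sequence of consecutive terms of the cyclic sequence $(1,2,\dots,n,n,n-1,\dots,2,1)$ (read cyclically, in one of the two directions).
   Context: Graphs may contain multiple edges, loops and semi-edges (links with a single endpoint, contributing 1 to the degree). $P_n$ is the path with vertices $1,2,\dots,n$ and edges $\{i,i+1\}$; $P_n^{(3)}$ is the 3-regular graph obtained from $P_n$ by attaching $3-\deg_{P_n}(i)$ semi-edges to every vertex $i$ (so for $n\ge 2$ the end vertices get two semi-edges, the inner vertices one; for $n=1$ the single vertex gets three). The cyclic sequence $(1,2,\dots,n,n,\dots,1)$ is the sequence of images along the cycle $C_{2n}^{(3)}$ (a $2n$-cycle with one semi-edge at every vertex) under its natural covering projection onto $P_n^{(3)}$. A covering projection $f:G\to H$ maps vertices to vertices and links to links such that the preimage of each edge $uv$ of $H$ is a perfect matching between $f^{ -1}(u)$ and $f^{ -1}(v)$, the preimage of each loop at $u$ is a disjoint union of cycles spanning $f^{ -1}(u)$, and the preimage of each semi-edge at $u$ is a disjoint union of edges and semi-edges spanning $f^{ -1}(u)$. -}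

module Defs where

open import Data.Nat using (ℕ; zero; suc; _+_; _∸_; _<_; _<?_)
open import Data.Nat.DivMod using (_%_)
open import Data.Nat.Properties using (≤-refl; n<1+n)
open import Data.Fin using (Fin; zero; suc; toℕ; fromℕ<; inject₁)
open import Data.Fin.Properties using (toℕ-inject₁; toℕ-fromℕ<; toℕ-injective; toℕ<n)
open import Data.Product using (Σ; _×_; _,_; proj₁)
open import Function.Bundles using (_↔_)
open import Data.Empty using (⊥; ⊥-elim)
open import Data.Nat using (s≤s; _≤_)
open import Data.Nat.Properties using (suc-injective)
open import Relation.Nullary using (yes; no; ¬_; Dec)
open import Relation.Binary.PropositionalEquality using (_≡_; _≢_; refl; sym; trans; cong)

-- Graphs with multiple edges, loops and semi-edges, in the standard
-- dart ("half-link") model: every link consists of darts; an edge or a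
-- loop consists of two darts swapped by the involution `inv`, a
-- semi-edge of one dart fixed by `inv`.  `vert d` is the vertex the dart
-- d is attached to.  A loop is a pair {d, inv d} with d ≢ inv d and
-- vert d ≡ vert (inv d); an (ordinary) edge has vert d ≢ vert (inv d).

record Graph : Set₁ where
  field
    V     : Set
    D     : Set
    vert  : D → V
    inv   : D → D
    invol : ∀ d → inv (inv d) ≡ d
open Graph public

Finite : Set → Set
Finite A = Σ ℕ λ k → A ↔ Fin k

FiniteGraph : Graph → Set
FiniteGraph G = Finite (V G) × Finite (D G)

HasSemiEdge : (G : Graph) → V G → Set
HasSemiEdge G v = Σ (D G) λ d → (vert G d ≡ v) × (inv G d ≡ d)

Joined : (G : Graph) → V G → V G → Set
Joined G u w = Σ (D G) λ d → (vert G d ≡ u) × (vert G (inv G d) ≡ w)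

record PathIn (G : Graph) (m : ℕ) : Set where
  field
    q        : Fin m → V G
    distinct : ∀ i j → q i ≡ q j → i ≡ j
    adjacent : ∀ (i j : Fin m) → toℕ j ≡ suc (toℕ i) → Joined G (q i) (q j)
open PathIn public

record Covering (G H : Graph) : Set where
  field
    fV       : V G → V H
    fD       : D G → D H
    vert-hom : ∀ d → vert H (fD d) ≡ fV (vert G d)
    inv-hom  : ∀ d → fD (inv G d) ≡ inv H (fD d)
    loc-inj  : ∀ d d' → vert G d ≡ vert G d' → fD d ≡ fD d' → d ≡ d'
    loc-surj : ∀ (v : V G) (e : D H) → vert H e ≡ fV v →
               Σ (D G) λ d → (vert G d ≡ v) × (fD d ≡ e)
open Covering public

-- Vertex i : Fin n stands for the vertex toℕ i + 1
-- of the paper.  Every vertex has three darts: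
--   L : the dart of the edge to the left neighbour, or a semi-edge if i is the first vertex
--   R : the dart of the edge to the right neighbour, or a semi-edge if i is the last vertex
--   S : a semi-edge.
-- So inner vertices get one semi-edge, end vertices two, and for n = 1
-- the single vertex gets three.

data Slot : Set where
  L R S : Slot

invL : (n : ℕ) → Fin n → Fin n × Slot
invL n zero    = zero , L
invL n (suc j) = inject₁ j , R

invR : (n : ℕ) (i : Fin n) → Dec (suc (toℕ i) < n) → Fin n × Slot
invR n i (yes p) = fromℕ< p , L
invR n i (no  _) = i , R

invP : (n : ℕ) → Fin n × Slot → Fin n × Slot
invP n (i , L) = invL n i
invP n (i , R) = invR n i (suc (toℕ i) <? n)
invP n (i , S) = i , S

private
  fromℕ<-suc : ∀ {k} (j : Fin k) (p : suc (toℕ (inject₁ j)) < suc k) → fromℕ< p ≡ suc j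
  fromℕ<-suc j p = toℕ-injective (trans (toℕ-fromℕ< p) (cong suc (toℕ-inject₁ j)))

  invP-R-suc : ∀ {k} (j : Fin k) → invP (suc k) (inject₁ j , R) ≡ (suc j , L)
  invP-R-suc {k} j with suc (toℕ (inject₁ j)) <? suc k
  ... | yes p = cong (_, L) (fromℕ<-suc j p)
  ... | no ¬p = ⊥-elim (¬p (s≤s (subst′ (toℕ<n j))))
    where
      subst′ : toℕ j < k → suc (toℕ (inject₁ j)) ≤ k
      subst′ h rewrite toℕ-inject₁ j = h

invP-invol : ∀ n x → invP n (invP n x) ≡ x
invP-invol n (zero , L) = refl
invP-invol (suc k) (suc j , L) = invP-R-suc j
invP-invol n (i , R) = helper (suc (toℕ i) <? n)
  where
    noCase : ¬ (suc (toℕ i) < n) → (d : Dec (suc (toℕ i) < n)) → invR n i d ≡ (i , R)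
    noCase ¬p (yes p) = ⊥-elim (¬p p)
    noCase ¬p (no _)  = refl
    lemma : ∀ (p : suc (toℕ i) < n) (x : Fin n) → x ≡ fromℕ< p → invL n x ≡ (i , R)
    lemma p zero e = ⊥-elim (0≢ (trans (cong toℕ e) (toℕ-fromℕ< p)))
      where
        0≢ : ∀ {a} → 0 ≡ suc a → ⊥
        0≢ ()
    lemma p (suc j) e = cong (_, R) (toℕ-injective
      (trans (toℕ-inject₁ j) (suc-injective
        (trans (cong toℕ e) (toℕ-fromℕ< p)))))
    helper : (d : Dec (suc (toℕ i) < n)) → invP n (invR n i d) ≡ (i , R)
    helper (yes p) = lemma p (fromℕ< p) refl
    helper (no ¬p) = noCase ¬p (suc (toℕ i) <? n)
invP-invol n (i , S) = refl

P3 : ℕ → Graph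
P3 n = record
  { V     = Fin n
  ; D     = Fin n × Slot
  ; vert  = proj₁
  ; inv   = invP n
  ; invol = invP-invol n
  }

-- The cyclic sequence (1, 2, …, n, n, …, 2, 1) of length 2n, indexed by
-- ℕ and read periodically: cyc n k is its (k mod 2n)-th term (0-based).

cyc : ℕ → ℕ → ℕ
cyc zero    k = 0
cyc (suc n) k with (k % (suc n + suc n)) <? suc n
... | yes _ = suc (k % (suc n + suc n))
... | no  _ = (suc n + suc n) ∸ (k % (suc n + suc n))

-- Write xⱼ = f(qⱼ). At qⱼ the semi-edge and the darts towards qⱼ₋₁ and qⱼ₊₁ have pairwise
-- different far ends, so f maps them to three distinct darts at xⱼ, one of them a semi-edge.
-- In P_n^(3) this forces xⱼ₊₁ to be a neighbour of xⱼ, or xⱼ itself at an end vertex, and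
-- xⱼ₊₁ ≢ xⱼ₋₁ unless n = 1.  So (xⱼ) is a non-backtracking walk in P_n with a semi-edge at
-- each end; such a walk is fixed by its first step, hence it is the projection of a walk
-- around the 2n-cycle covering this graph, and that cycle projects to (1, …, n, n, …, 1).

module Submission where

open import Defs
open import Data.Nat using (ℕ; zero; suc; _+_; _∸_; _≤_; _<_; _<?_; z≤n; s≤s; NonZero)
open import Data.Nat.Properties
  using (≤-trans; ≤-antisym; ≮⇒≥; <⇒≱; m≤m+n; ∸-monoʳ-≤; ∸-monoʳ-<; m+n∸n≡m; m∸[m∸n]≡n;
         +-∸-assoc; +-identityʳ; +-suc; 0≢1+n; 1+n≢n; m≢1+n+m)
open import Data.Nat.DivMod using (_%_; %-distribˡ-+; m<n⇒m%n≡m; m%n%n≡m%n; n%n≡0)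
open import Data.Nat.GeneralisedArithmetic using (iterate)
open import Data.Fin using (Fin; toℕ; zero; suc; fromℕ<; inject₁)
open import Data.Fin.Properties using (toℕ<n; toℕ-fromℕ<; toℕ-inject₁)
open import Data.Product using (Σ; _×_; _,_; proj₁; proj₂)
open import Data.Sum using (_⊎_; inj₁; inj₂)
open import Data.Empty using (⊥-elim)
open import Function using (_∘_)
open import Relation.Nullary using (yes; no)
open import Relation.Binary.PropositionalEquality
  using (_≡_; _≢_; refl; sym; trans; cong; subst; ≢-sym; module ≡-Reasoning)

far : (G : Graph) → D G → V G
far G d = vert G (inv G d)

semi-edge-joins : ∀ G {u} → HasSemiEdge G u → Joined G u u
semi-edge-joins G (σ , σ-at-u , σ-fixed) = σ , σ-at-u , trans (cong (vert G) σ-fixed) σ-at-u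

Joined-sym : ∀ G {u w} → Joined G u w → Joined G w u
Joined-sym G (d , d-at-u , d-to-w) = inv G d , d-to-w , trans (cong (vert G) (invol G d)) d-at-u

module _ {G H : Graph} (f : Covering G H) where

  Joined-image : ∀ {u w} → Joined G u w → Joined H (fV f u) (fV f w)
  Joined-image (d , d-at-u , d-to-w) = fD f d , trans (vert-hom f d) (cong (fV f) d-at-u) , fd-to-fw
    where
      open ≡-Reasoning
      fd-to-fw : far H (fD f d) ≡ fV f _
      fd-to-fw = begin
        vert H (inv H (fD f d))  ≡⟨ cong (vert H) (inv-hom f d) ⟨
        vert H (fD f (inv G d))  ≡⟨ vert-hom f (inv G d) ⟩
        fV f (far G d)           ≡⟨ cong (fV f) d-to-w ⟩
        fV f _                   ∎

  Joined-image-≢ : ∀ {u w w′} (J : Joined G u w) (J′ : Joined G u w′) → w ≢ w′ →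
                   proj₁ (Joined-image J) ≢ proj₁ (Joined-image J′)
  Joined-image-≢ (d , d-at-u , d-to-w) (d′ , d′-at-u , d′-to-w′) w≢w′ fd≡fd′ = w≢w′ (begin
    _         ≡⟨ d-to-w ⟨
    far G d   ≡⟨ cong (far G) (loc-inj f d d′ (trans d-at-u (sym d′-at-u)) fd≡fd′) ⟩
    far G d′  ≡⟨ d′-to-w′ ⟩
    _         ∎)
    where open ≡-Reasoning

module _ {G : Graph} {m} (Q : PathIn G m) where

  q-≢ : ∀ {i j} → toℕ i ≢ toℕ j → q Q i ≢ q Q j
  q-≢ i≢j qi≡qj = i≢j (cong toℕ (distinct Q _ _ qi≡qj))

  consecutive-≢ : ∀ {i j} → toℕ j ≡ suc (toℕ i) → q Q j ≢ q Q i
  consecutive-≢ j≡1+i = q-≢ (λ j≡i → 1+n≢n (trans (sym j≡1+i) j≡i))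

  two-apart-≢ : ∀ {i j k : Fin m} → toℕ j ≡ suc (toℕ i) → toℕ k ≡ suc (toℕ j) → q Q i ≢ q Q k
  two-apart-≢ j≡1+i k≡1+j = q-≢ (λ i≡k → m≢1+n+m _ (trans i≡k (trans k≡1+j (cong suc j≡1+i))))

-- The arc (i , up) stands for the dart (i , R) of P_n^(3) and (i , down) for (i , L) (see
-- invP-dart): next follows an arc and leaves its far end through the other one of L and R.
data Dir : Set where
  up down : Dir

flip : Dir → Dir
flip up   = down
flip down = up

Arc : ℕ → Set
Arc n = Fin n × Dir

reverse : ∀ {n} → Arc n → Arc n
reverse (i , d) = i , flip d

reverse-involutive : ∀ {n} (c : Arc n) → reverse (reverse c) ≡ c
reverse-involutive (_ , up)   = refl
reverse-involutive (_ , down) = refl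

next : ∀ {n} → Arc n → Arc n
next {n} (i , up) with suc (toℕ i) <? n
... | yes i+1<n = fromℕ< i+1<n , up
... | no  _     = i , down
next (zero  , down) = zero , up
next (suc i , down) = inject₁ i , down

slot : Dir → Slot
slot up   = R
slot down = L

dart : ∀ {n} → Arc n → Fin n × Slot
dart (i , d) = i , slot d

dart-injective : ∀ {n} {c c′ : Arc n} → dart c ≡ dart c′ → c ≡ c′
dart-injective {c = _ , up}   {_ , up}   refl = refl
dart-injective {c = _ , down} {_ , down} refl = refl

invP-dart : ∀ {n} (c : Arc n) → invP n (dart c) ≡ dart (reverse (next c))
invP-dart {n} (i , up) with suc (toℕ i) <? n
... | yes _ = refl
... | no  _ = refl
invP-dart (zero  , down) = refl
invP-dart (suc i , down) = refl

next-reverse-next : ∀ {n} (c : Arc n) → next (reverse (next c)) ≡ reverse c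
next-reverse-next {n} c = begin
  next (reverse (next c))                      ≡⟨ reverse-involutive _ ⟨
  reverse (reverse (next (reverse (next c))))  ≡⟨ cong reverse (dart-injective reversed-twice) ⟩
  reverse c                                    ∎
  where
    open ≡-Reasoning
    reversed-twice : dart (reverse (next (reverse (next c)))) ≡ dart c
    reversed-twice = begin
      dart (reverse (next (reverse (next c))))  ≡⟨ invP-dart (reverse (next c)) ⟨
      invP n (dart (reverse (next c)))          ≡⟨ cong (invP n) (invP-dart c) ⟨
      invP n (invP n (dart c))                  ≡⟨ invP-invol n (dart c) ⟩
      dart c                                    ∎

far-dart : ∀ {n} (c : Arc n) → far (P3 n) (dart c) ≡ proj₁ (next c)
far-dart c = cong proj₁ (invP-dart c)

Step : ∀ {n} → Fin n → Fin n → Set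
Step u w = Σ Dir λ d → proj₁ (next (u , d)) ≡ w

far-L≡far-R⇒n≡1 : ∀ {n} (v : Fin n) → far (P3 n) (v , L) ≡ far (P3 n) (v , R) → n ≡ 1
far-L≡far-R⇒n≡1 {n} v eq with suc (toℕ v) <? n
far-L≡far-R⇒n≡1 zero    eq | yes 1<n = ⊥-elim (0≢1+n (trans (cong toℕ eq) (toℕ-fromℕ< 1<n)))
far-L≡far-R⇒n≡1 zero    _  | no  1≮n = ≤-antisym (≮⇒≥ 1≮n) (s≤s z≤n)
far-L≡far-R⇒n≡1 (suc i) eq | yes i+2<n =
  ⊥-elim (m≢1+n+m (toℕ i) (trans (sym (toℕ-inject₁ i)) (trans (cong toℕ eq) (toℕ-fromℕ< i+2<n))))
far-L≡far-R⇒n≡1 (suc i) eq | no  _ =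
  ⊥-elim (m≢1+n+m (toℕ i) (trans (sym (toℕ-inject₁ i)) (cong toℕ eq)))

Step-beside-semi-edge : ∀ {n} {v w : Fin n} (E : Joined (P3 n) v w) (T : Joined (P3 n) v v) →
                        proj₁ E ≢ proj₁ T → Step v w
Step-beside-semi-edge ((v , L) , refl , refl) _ _ = down , sym (far-dart (v , down))
Step-beside-semi-edge ((v , R) , refl , refl) _ _ = up , sym (far-dart (v , up))
Step-beside-semi-edge ((v , S) , refl , refl) ((.v , L) , refl , T-loop) _ =
  down , trans (sym (far-dart (v , down))) T-loop
Step-beside-semi-edge ((v , S) , refl , refl) ((.v , R) , refl , T-loop) _ =
  up , trans (sym (far-dart (v , up))) T-loop
Step-beside-semi-edge ((v , S) , refl , refl) ((.v , S) , refl , _) E≢T = ⊥-elim (E≢T refl)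

two-semi-edges-beside-S⇒n≡1 : ∀ {n} {v : Fin n} (E T : Joined (P3 n) v v) →
  proj₁ E ≢ proj₁ T → proj₁ E ≢ (v , S) → proj₁ T ≢ (v , S) → n ≡ 1
two-semi-edges-beside-S⇒n≡1 ((v , L) , refl , l) ((.v , R) , refl , r) _ _ _ =
  far-L≡far-R⇒n≡1 v (trans l (sym r))
two-semi-edges-beside-S⇒n≡1 ((v , R) , refl , r) ((.v , L) , refl , l) _ _ _ =
  far-L≡far-R⇒n≡1 v (trans l (sym r))
two-semi-edges-beside-S⇒n≡1 ((v , S) , refl , _) _ _ E≢S _ = ⊥-elim (E≢S refl)
two-semi-edges-beside-S⇒n≡1 ((v , _) , refl , _) ((.v , S) , refl , _) _ _ T≢S = ⊥-elim (T≢S refl)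
two-semi-edges-beside-S⇒n≡1 ((v , L) , refl , _) ((.v , L) , refl , _) E≢T _ _ = ⊥-elim (E≢T refl)
two-semi-edges-beside-S⇒n≡1 ((v , R) , refl , _) ((.v , R) , refl , _) E≢T _ _ = ⊥-elim (E≢T refl)

parallel-beside-semi-edge⇒n≡1 : ∀ {n} {v w w′ : Fin n}
  (A : Joined (P3 n) v w) (E : Joined (P3 n) v w′) (T : Joined (P3 n) v v) → w ≡ w′ →
  proj₁ A ≢ proj₁ E → proj₁ A ≢ proj₁ T → proj₁ E ≢ proj₁ T → n ≡ 1
parallel-beside-semi-edge⇒n≡1 ((v , L) , refl , refl) ((.v , R) , refl , refl) _ w≡w′ _ _ _ =
  far-L≡far-R⇒n≡1 v w≡w′
parallel-beside-semi-edge⇒n≡1 ((v , R) , refl , refl) ((.v , L) , refl , refl) _ w≡w′ _ _ _ =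
  far-L≡far-R⇒n≡1 v (sym w≡w′)
parallel-beside-semi-edge⇒n≡1 ((v , S) , refl , refl) ((.v , s) , refl , refl) T w≡w′ A≢E A≢T E≢T =
  two-semi-edges-beside-S⇒n≡1 ((v , s) , refl , sym w≡w′) T E≢T (≢-sym A≢E) (≢-sym A≢T)
parallel-beside-semi-edge⇒n≡1 ((v , s) , refl , refl) ((.v , S) , refl , refl) T w≡w′ A≢E A≢T E≢T =
  two-semi-edges-beside-S⇒n≡1 ((v , s) , refl , w≡w′) T A≢T A≢E (≢-sym E≢T)
parallel-beside-semi-edge⇒n≡1 ((v , L) , refl , refl) ((.v , L) , refl , refl) _ _ A≢E _ _ =
  ⊥-elim (A≢E refl)
parallel-beside-semi-edge⇒n≡1 ((v , R) , refl , refl) ((.v , R) , refl , refl) _ _ A≢E _ _ =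
  ⊥-elim (A≢E refl)

arc-or-reverse : ∀ {n} (c : Arc n) d → (proj₁ c , d) ≡ c ⊎ (proj₁ c , d) ≡ reverse c
arc-or-reverse (_ , up)   up   = inj₁ refl
arc-or-reverse (_ , up)   down = inj₂ refl
arc-or-reverse (_ , down) up   = inj₂ refl
arc-or-reverse (_ , down) down = inj₁ refl

Fin-unique : ∀ {n} → n ≡ 1 → (i j : Fin n) → i ≡ j
Fin-unique refl zero zero = refl

next-determined : ∀ {n} (c : Arc n) {y} → Step (proj₁ (next c)) y →
                  (y ≡ proj₁ c → n ≡ 1) → proj₁ (next (next c)) ≡ y
next-determined c {y} (d , reach) backtracks with arc-or-reverse (next c) d
... | inj₁ same = trans (cong (proj₁ ∘ next) (sym same)) reach
... | inj₂ back = Fin-unique (backtracks y≡c) _ _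
  where
    open ≡-Reasoning
    y≡c : y ≡ proj₁ c
    y≡c = begin
      y                                  ≡⟨ reach ⟨
      proj₁ (next (proj₁ (next c) , d))  ≡⟨ cong (proj₁ ∘ next) back ⟩
      proj₁ (next (reverse (next c)))    ≡⟨ cong proj₁ (next-reverse-next c) ⟩
      proj₁ c                            ∎

IsWalk : ∀ {m n} → (Fin m → Fin n) → Set
IsWalk x = ∀ i j → toℕ j ≡ suc (toℕ i) → Step (x i) (x j)

-- For n ≥ 2 a walk backtracks exactly when it is back after two steps; for n = 1 every walk
-- stays at the only vertex.
NonBacktracking : ∀ {m n} → (Fin m → Fin n) → Set
NonBacktracking {m} {n} x =
  ∀ (i j k : Fin m) → toℕ j ≡ suc (toℕ i) → toℕ k ≡ suc (toℕ j) → x k ≡ x i → n ≡ 1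

walk-follows-arc : ∀ {m n} (x : Fin (suc (suc m)) → Fin n) → IsWalk x → NonBacktracking x →
                   (c : Arc n) → proj₁ c ≡ x zero → proj₁ (next c) ≡ x (suc zero) →
                   ∀ j → x j ≡ proj₁ (iterate next c (toℕ j))
walk-follows-arc x _ _ c x₀ _ zero = sym x₀
walk-follows-arc {zero} x _ _ c _ x₁ (suc zero) = sym x₁
walk-follows-arc {suc m} x walk nonBack c x₀ x₁ (suc j) =
  walk-follows-arc (x ∘ suc) (λ i j j≡1+i → walk (suc i) (suc j) (cong suc j≡1+i))
    (λ i j k j≡1+i k≡1+j → nonBack (suc i) (suc j) (suc k) (cong suc j≡1+i) (cong suc k≡1+j))
    (next c) x₁ x₂ j
  where
    x₂ : proj₁ (next (next c)) ≡ x (suc (suc zero))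
    x₂ = next-determined c
      (subst (λ u → Step u _) (sym x₁) (walk (suc zero) (suc (suc zero)) refl))
      (λ x₂≡c → nonBack zero (suc zero) (suc (suc zero)) refl refl (trans x₂≡c x₀))

walk-lifts : ∀ {m n} (x : Fin (suc m) → Fin n) → IsWalk x → NonBacktracking x →
             Σ (Arc n) λ c → ∀ j → x j ≡ proj₁ (iterate next c (toℕ j))
walk-lifts {zero} x _ _ = (x zero , up) , λ { zero → refl }
walk-lifts {suc m} x walk nonBack with walk zero (suc zero) refl
... | d , x₁ = (x zero , d) , walk-follows-arc x walk nonBack (x zero , d) refl x₁

[m%d+n]%d≡[m+n]%d : ∀ m n d .{{_ : NonZero d}} → (m % d + n) % d ≡ (m + n) % d
[m%d+n]%d≡[m+n]%d m n d = begin
  (m % d + n) % d          ≡⟨ %-distribˡ-+ (m % d) n d ⟩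
  (m % d % d + n % d) % d  ≡⟨ cong (λ r → (r + n % d) % d) (m%n%n≡m%n m d) ⟩
  (m % d + n % d) % d      ≡⟨ %-distribˡ-+ m n d ⟨
  (m + n) % d              ∎
  where open ≡-Reasoning

-- Arcs are the vertices of the 2n-cycle covering P_n; position-next says that next rotates it.
position : ∀ {n} → Arc n → ℕ
position     (i , up)   = toℕ i
position {n} (i , down) = (n + n) ∸ suc (toℕ i)

module _ {n : ℕ} where

  private
    N : ℕ
    N = suc n + suc n

    n<N : ∀ {k} → k < suc n → k < N
    n<N k<n = ≤-trans k<n (m≤m+n (suc n) (suc n))

  position< : (c : Arc (suc n)) → position c < N
  position< (i , up)   = n<N (toℕ<n i)
  position< (i , down) = ∸-monoʳ-< (s≤s z≤n) (n<N (toℕ<n i))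

  suc-n≤position-down : (i : Fin (suc n)) → suc n ≤ position (i , down)
  suc-n≤position-down i = subst (_≤ N ∸ suc (toℕ i)) (m+n∸n≡m (suc n) (suc n)) (∸-monoʳ-≤ N (toℕ<n i))

  cyc-position : ∀ k (c : Arc (suc n)) → k % N ≡ position c → cyc (suc n) k ≡ suc (toℕ (proj₁ c))
  cyc-position k (i , up) k≡i with k % N <? suc n
  ... | yes _   = cong suc k≡i
  ... | no  k≮n = ⊥-elim (k≮n (subst (_< suc n) (sym k≡i) (toℕ<n i)))
  cyc-position k (i , down) k≡N-1-i with k % N <? suc n
  ... | yes k<n = ⊥-elim (<⇒≱ k<n (subst (suc n ≤_) (sym k≡N-1-i) (suc-n≤position-down i)))
  ... | no  _   = trans (cong (N ∸_) k≡N-1-i) (m∸[m∸n]≡n (n<N (toℕ<n i)))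

  %-position-exact : ∀ {k} (c : Arc (suc n)) → k ≡ position c → k % N ≡ position c
  %-position-exact c k≡c = trans (m<n⇒m%n≡m (subst (_< N) (sym k≡c) (position< c))) k≡c

  position-next : (c : Arc (suc n)) → suc (position c) % N ≡ position (next c)
  position-next (i , up) with suc (toℕ i) <? suc n
  ... | yes i+1<n = %-position-exact (fromℕ< i+1<n , up) (sym (toℕ-fromℕ< i+1<n))
  ... | no  i+1≮n = %-position-exact (i , down) (begin
      suc (toℕ i)          ≡⟨ i+1≡n ⟩
      suc n                ≡⟨ m+n∸n≡m (suc n) (suc n) ⟨
      N ∸ suc n            ≡⟨ cong (N ∸_) i+1≡n ⟨
      N ∸ suc (toℕ i)      ∎)
    where
      open ≡-Reasoning
      i+1≡n : suc (toℕ i) ≡ suc n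
      i+1≡n = ≤-antisym (toℕ<n i) (≮⇒≥ i+1≮n)
  position-next (zero , down) = n%n≡0 N
  position-next (suc i , down) = %-position-exact (inject₁ i , down) (begin
      suc (N ∸ suc (suc (toℕ i)))  ≡⟨ +-∸-assoc 1 (n<N (toℕ<n (suc i))) ⟨
      N ∸ suc (toℕ i)              ≡⟨ cong (λ k → N ∸ suc k) (toℕ-inject₁ i) ⟨
      N ∸ suc (toℕ (inject₁ i))    ∎)
    where open ≡-Reasoning

  position-iterate : (c : Arc (suc n)) (k : ℕ) → (position c + k) % N ≡ position (iterate next c k)
  position-iterate c zero    = %-position-exact c (+-identityʳ (position c))
  position-iterate c (suc k) = begin
    (position c + suc k) % N            ≡⟨ cong (_% N) (+-suc (position c) k) ⟩
    (suc (position c) + k) % N          ≡⟨ [m%d+n]%d≡[m+n]%d (suc (position c)) k N ⟨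
    (suc (position c) % N + k) % N      ≡⟨ cong (λ p → (p + k) % N) (position-next c) ⟩
    (position (next c) + k) % N         ≡⟨ position-iterate (next c) k ⟩
    position (iterate next (next c) k)  ∎
    where open ≡-Reasoning

  cyc-iterate : (c : Arc (suc n)) (k : ℕ) →
                cyc (suc n) (position c + k) ≡ suc (toℕ (proj₁ (iterate next c k)))
  cyc-iterate c k = cyc-position (position c + k) (iterate next c k) (position-iterate c k)

module _ {n} {G : Graph} (f : Covering G (P3 n)) {m} (Q : PathIn G m)
         (semi : ∀ i → HasSemiEdge G (q Q i)) where

  image-IsWalk : IsWalk (fV f ∘ q Q)
  image-IsWalk i j j≡1+i =
    Step-beside-semi-edge (Joined-image f E) (Joined-image f T)
      (Joined-image-≢ f E T (consecutive-≢ Q j≡1+i))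
    where
      E : Joined G (q Q i) (q Q j)
      E = adjacent Q i j j≡1+i
      T : Joined G (q Q i) (q Q i)
      T = semi-edge-joins G (semi i)

  image-NonBacktracking : NonBacktracking (fV f ∘ q Q)
  image-NonBacktracking i j k j≡1+i k≡1+j xk≡xi =
    parallel-beside-semi-edge⇒n≡1 (Joined-image f A) (Joined-image f E) (Joined-image f T) (sym xk≡xi)
      (Joined-image-≢ f A E (two-apart-≢ Q j≡1+i k≡1+j))
      (Joined-image-≢ f A T (≢-sym (consecutive-≢ Q j≡1+i)))
      (Joined-image-≢ f E T (consecutive-≢ Q k≡1+j))
    where
      A : Joined G (q Q j) (q Q i)
      A = Joined-sym G (adjacent Q i j j≡1+i)
      E : Joined G (q Q j) (q Q k)
      E = adjacent Q j k k≡1+j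
      T : Joined G (q Q j) (q Q j)
      T = semi-edge-joins G (semi j)

mainTheorem5 : (n : ℕ) → 1 ≤ n →
    (G : Graph) → FiniteGraph G →
    (f : Covering G (P3 n)) →
    (m : ℕ) (Q : PathIn G m) →
    (∀ (i : Fin m) → HasSemiEdge G (q Q i)) →
    Σ ℕ λ s →
      (∀ (j : Fin m) → suc (toℕ (fV f (q Q j))) ≡ cyc n (s + toℕ j))
      ⊎ (∀ (j : Fin m) → suc (toℕ (fV f (q Q j))) ≡ cyc n (s + (m ∸ suc (toℕ j))))
mainTheorem5 zero    ()
mainTheorem5 (suc n) _ G _ f zero    Q semi = 0 , inj₁ λ ()
mainTheorem5 (suc n) _ G _ f (suc m) Q semi = position c , inj₁ on-cycle
  where
    lift : Σ (Arc (suc n)) λ c → ∀ j → fV f (q Q j) ≡ proj₁ (iterate next c (toℕ j))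
    lift = walk-lifts (fV f ∘ q Q) (image-IsWalk f Q semi) (image-NonBacktracking f Q semi)
    c : Arc (suc n)
    c = proj₁ lift
    on-cycle : ∀ j → suc (toℕ (fV f (q Q j))) ≡ cyc (suc n) (position c + toℕ j)
    on-cycle j = trans (cong (suc ∘ toℕ) (proj₂ lift j)) (sym (cyc-iterate c (toℕ j)))
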